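{- Let $G$ be a $(k,\rho)$-geodesic-coverable graph and $\mathcal{P}$ a $(k,\rho)$-geodesic-cover of $G$. For every shortest path $P$ in $G$ there exists a $\rho$-snappath $Q$ (with respect to $\mathcal{P}$) with $\mathrm{Start}(Q)=\mathrm{Start}(P)$, $\mathrm{End}(Q)=\mathrm{End}(P)$, and $\big||P|-|Q|\big|\le 4\rho k$.
   Context: Graphs are finite, undirected and unweighted; $\mathrm{dist}$ is shortest-path distance. A walk is a sequence of vertices $v_0,\dots,v_\ell$ with consecutive vertices adjacent; its length is $\ell$, its start is $v_0$ and end $v_\ell$. A geodesic is a path that is a shortest path between its endpoints. A $(k,\rho)$-geodesic-cover of $G$ is a family $\mathcal{P}$ of $k$ geodesics such that every vertex of $G$ is at distance at most $\rho$ from some vertex of some path in $\mathcal{P}$; $G$ is $(k,\rho)$-geodesic-coverable if it has one. A $\rho$-snappath (w.r.t. $\mathcal{P}$) is a sequence $Q=(R_0,Q_1,R_1,\dots,Q_{k'},R_{k'})$ with $k'\le k$ such that: each $Q_i$ is a subpath of a geodesic in $\mathcal{P}$; for every $P\in\mathcal{P}$ there is at most one $i$ with $Q_i$ a subpath of $P$; each $R_i$ is a walk of length at most $2\rho+1$, and $R_0,R_{k'}$ have length at most $\rho$; and $\mathrm{End}(R_{i-1})=\mathrm{Start}(Q_i)$, $\mathrm{End}(Q_i)=\mathrm{Start}(R_i)$ for all $i$. Its concatenation is the walk $R_0\cdot Q_1\cdot R_1\cdots Q_{k'}\cdot R_{k'}$, and $|Q|$, $\mathrm{Start}(Q)$,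 $\mathrm{End}(Q)$ denote the length, start and end of this concatenation. -}

module Defs where

open import Level using (0ℓ)
open import Data.Nat using (ℕ; suc; _+_; _*_; _≤_)
open import Data.Fin using (Fin; inject₁; fromℕ) renaming (suc to fsuc)
open import Data.List using (List; _++_; reverse)
open import Data.List.NonEmpty using (List⁺; toList; head; last; length)
open import Data.List.Relation.Unary.Linked using (Linked)
open import Data.List.Relation.Unary.Unique.Propositional using (Unique)
open import Data.List.Membership.Propositional using (_∈_)
open import Data.Product using (Σ; ∃; ∃-syntax; _×_)
open import Data.Sum using (_⊎_)
open import Relation.Nullary using (¬_)
open import Relation.Binary.PropositionalEquality using (_≡_)

record Graph : Set₁ where
  field
    n      : ℕ
    Adj    : Fin n → Fin n → Set
    sym    : ∀ {u v} → Adj u v → Adj v u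
    irrefl : ∀ {u} → ¬ Adj u u

module _ (G : Graph) where
  open Graph G

  V : Set
  V = Fin n

  IsWalk : List⁺ V → Set
  IsWalk w = Linked Adj (toList w)

  walkLength : List⁺ V → ℕ
  walkLength w = Data.List.length (Data.List.NonEmpty.tail w)

  Start End : List⁺ V → V
  Start w = head w
  End w = last w

  DistLe : V → V → ℕ → Set
  DistLe u v d = Σ (List⁺ V) λ w → IsWalk w × Start w ≡ u × End w ≡ v × walkLength w ≤ d
  IsGeodesic : List⁺ V → Set
  IsGeodesic P = IsWalk P × Unique (toList P) ×
    (∀ (w : List⁺ V) → IsWalk w → Start w ≡ Start P → End w ≡ End P → walkLength P ≤ walkLength w)

  IsGeodesicCover : (k ρ : ℕ) → (Fin k → List⁺ V) → Set
  IsGeodesicCover k ρ 𝒫 = (∀ j → IsGeodesic (𝒫 j)) ×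
    (∀ (v : V) → ∃[ j ] ∃[ u ] (u ∈ toList (𝒫 j) × DistLe v u ρ))

  GeodesicCoverable : (k ρ : ℕ) → Set
  GeodesicCoverable k ρ = Σ (Fin k → List⁺ V) (IsGeodesicCover k ρ)

  SubpathOf : List⁺ V → List⁺ V → Set
  SubpathOf Q P = ∃[ as ] ∃[ bs ]
    (toList P ≡ as ++ toList Q ++ bs ⊎ reverse (toList P) ≡ as ++ toList Q ++ bs)

  sumFin : ∀ {m} → (Fin m → ℕ) → ℕ
  sumFin {ℕ.zero} f = 0
  sumFin {suc m} f = f Data.Fin.zero + sumFin (λ i → f (fsuc i))

  -- A ρ-snappath w.r.t. 𝒫: (R₀, Q₁, R₁, …, Q_{k'}, R_{k'}), Q's indexed by Fin k', R's by Fin (k'+1).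
  record Snappath (k ρ : ℕ) (𝒫 : Fin k → List⁺ V) : Set where
    field
      k'      : ℕ
      k'≤k    : k' ≤ k
      Qs      : Fin k' → List⁺ V
      Rs      : Fin (suc k') → List⁺ V
      Q-walk  : ∀ i → IsWalk (Qs i)
      R-walk  : ∀ i → IsWalk (Rs i)
      Q-sub   : ∀ i → ∃[ j ] SubpathOf (Qs i) (𝒫 j)
      Q-once  : ∀ j i i' → SubpathOf (Qs i) (𝒫 j) → SubpathOf (Qs i') (𝒫 j) → i ≡ i'
      R-len   : ∀ i → walkLength (Rs i) ≤ 2 * ρ + 1
      R₀-len  : walkLength (Rs Data.Fin.zero) ≤ ρ
      Rlast-len : walkLength (Rs (fromℕ k')) ≤ ρ
      link₁   : ∀ i → End (Rs (inject₁ i)) ≡ Start (Qs i)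
      link₂   : ∀ i → End (Qs i) ≡ Start (Rs (fsuc i))

    -- length, start and end of the concatenation R₀·Q₁·R₁⋯Q_{k'}·R_{k'}
    sLength : ℕ
    sLength = sumFin (λ i → walkLength (Rs i)) + sumFin (λ i → walkLength (Qs i))

    sStart : V
    sStart = Start (Rs Data.Fin.zero)

    sEnd : V
    sEnd = End (Rs (fromℕ k'))

module Submission where

open import Defs
open import Level using (0ℓ)
open import Data.Nat using (ℕ; zero; suc; _+_; _*_; _≤_; _<_; s≤s; ∣_-_∣)
open import Data.Nat.Properties using (≤-trans; +-mono-≤; +-monoʳ-≤; m≤m+n; m≤n+m; *-monoʳ-≤; +-comm; +-identityʳ; +-cancelˡ-≤; +-cancelʳ-≤; m≤n⇒∣m-n∣≡n∸m; m≤n+o⇒m∸n≤o; module ≤-Reasoning)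
open import Data.Nat.Induction using (<-wellFounded)
open import Data.Nat.Tactic.RingSolver using (solve-∀)
open import Data.Fin using (Fin; fromℕ; inject₁) renaming (zero to fzero; suc to fsuc)
open import Data.Fin.Properties using (any?; injective⇒≤) renaming (_≟_ to _≟ᶠ_)
open import Data.List using (List; []; _∷_; _++_; _∷ʳ_; [_]; length; reverse; initLast; _∷ʳ′_)
open import Data.List.Properties using (length-++; ++-assoc; ++-identityʳ; unfold-reverse; reverse-++; reverse-involutive)
open import Data.List.NonEmpty using (List⁺; _∷_; last; tail; toList)
open import Data.List.Relation.Unary.Linked using (Linked; [-]; _∷_)
open import Data.List.Relation.Unary.All using (All; []; _∷_)
import Data.List.Relation.Unary.All as All
open import Data.List.Relation.Unary.Any using (here; there)
open import Data.List.Relation.Unary.Any.Properties using (reverse⁻)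
open import Data.List.Membership.Propositional using (_∈_)
open import Data.List.Membership.Propositional.Properties using (∈-++⁺ˡ; ∈-++⁺ʳ; ∈-++⁻)
import Data.List.Membership.DecPropositional as DecMembership
open import Data.Product using (Σ; ∃; ∃₂; ∃-syntax; _×_; _,_; proj₁; proj₂)
open import Data.Sum using (_⊎_; inj₁; inj₂)
open import Data.Empty using (⊥; ⊥-elim)
open import Function using (_∘_)
open import Induction.WellFounded using (Acc; acc)
open import Relation.Nullary using (yes; no)
open import Relation.Nullary.Decidable using (_×-dec_)
open import Relation.Unary using (Pred; Decidable; ∁)
open import Relation.Binary.PropositionalEquality using (_≡_; refl; sym; trans; cong; subst; subst₂; module ≡-Reasoning)

-- Greedy construction: from the current vertex x of P, let y be the last vertex of P whose
-- anchor (a vertex of the cover within distance ρ of it) lies on a common cover geodesic with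
-- the anchor of x. Go from x to its anchor, along that geodesic to the anchor of y, back to y,
-- and continue from the successor of y. Segments of geodesics are shortest, so each hop costs at
-- most 4ρ more than the stretch of P it replaces. No cover geodesic is used twice: every later
-- hop starts at the anchor of a vertex beyond y, which by the choice of y shares no geodesic with
-- the anchor of x. So there are at most k hops, and the snappath is at most 4ρk longer than P,
-- and no shorter, since P is a geodesic.

last-∷ : ∀ {A : Set} (a c : A) xs → last (a ∷ c ∷ xs) ≡ last (c ∷ xs)
last-∷ a c xs with initLast xs
... | []       = refl
... | ys ∷ʳ′ y = refl

reverse-infix : ∀ {A : Set} (as qs bs : List A) {qs′} → reverse qs ≡ qs′ →
  reverse (as ++ qs ++ bs) ≡ reverse bs ++ qs′ ++ reverse as
reverse-infix as qs bs refl = begin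
  reverse (as ++ qs ++ bs)              ≡⟨ reverse-++ as (qs ++ bs) ⟩
  reverse (qs ++ bs) ++ reverse as      ≡⟨ cong (_++ reverse as) (reverse-++ qs bs) ⟩
  (reverse bs ++ reverse qs) ++ reverse as ≡⟨ ++-assoc (reverse bs) (reverse qs) (reverse as) ⟩
  reverse bs ++ reverse qs ++ reverse as ∎
  where open ≡-Reasoning

∣m-n∣≤o : ∀ {m n o} → m ≤ n → n ≤ m + o → ∣ m - n ∣ ≤ o
∣m-n∣≤o {m} {n} m≤n n≤m+o = subst (_≤ _) (sym (m≤n⇒∣m-n∣≡n∸m m≤n)) (m≤n+o⇒m∸n≤o n m n≤m+o)

n≤2n+1 : ∀ n → n ≤ 2 * n + 1
n≤2n+1 n = ≤-trans (m≤m+n n (n + 0)) (m≤m+n (2 * n) 1)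

module Walks (G : Graph) where
  open Graph G using (Adj) renaming (sym to Adj-sym)

  -- Walk a xs b is the walk a ∷ xs ending at b; its length is length xs.
  infixr 5 _∷_
  data Walk : V G → List (V G) → V G → Set where
    []  : ∀ {a} → Walk a [] a
    _∷_ : ∀ {a c xs b} → Adj a c → Walk c xs b → Walk a (c ∷ xs) b

  infixr 5 _++ʷ_
  _++ʷ_ : ∀ {a b c xs ys} → Walk a xs b → Walk b ys c → Walk a (xs ++ ys) c
  []      ++ʷ w′ = w′
  (e ∷ w) ++ʷ w′ = e ∷ (w ++ʷ w′)

  infixr 5 _++ʷ⟨_⟩_
  _++ʷ⟨_⟩_ : ∀ {a b c d xs ys} → Walk a xs b → b ≡ c → Walk c ys d → Walk a (xs ++ ys) d
  w ++ʷ⟨ refl ⟩ w′ = w ++ʷ w′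

  walk⇒IsWalk : ∀ {a xs b} → Walk a xs b → IsWalk G (a ∷ xs)
  walk⇒IsWalk []      = [-]
  walk⇒IsWalk (e ∷ w) = e ∷ walk⇒IsWalk w

  walk-End : ∀ {a xs b} → Walk a xs b → End G (a ∷ xs) ≡ b
  walk-End []                    = refl
  walk-End {a} (_∷_ {c = c} {xs} e w) = trans (last-∷ a c xs) (walk-End w)

  linked⇒walk : ∀ {a xs} → Linked Adj (a ∷ xs) → ∃ (Walk a xs)
  linked⇒walk {a} {[]}    _        = a , []
  linked⇒walk {xs = _ ∷ _} (e ∷ lk) = let b , w = linked⇒walk lk in b , e ∷ w

  IsWalk⇒walk : (w : List⁺ (V G)) → IsWalk G w → Walk (Start G w) (tail w) (End G w)
  IsWalk⇒walk (a ∷ xs) lk = let _ , w = linked⇒walk lk in subst (Walk a xs) (sym (walk-End w)) w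

  reverse-walk : ∀ {a xs b} → Walk a xs b →
    ∃ λ ys → Walk b ys a × reverse (a ∷ xs) ≡ b ∷ ys × length ys ≡ length xs
  reverse-walk []                  = [] , [] , refl , refl
  reverse-walk {a} (_∷_ {c = c} {xs} e w) with reverse-walk w
  ... | ys , w′ , rev , len =
    ys ∷ʳ a , w′ ++ʷ (Adj-sym e ∷ []) ,
    trans (unfold-reverse a (c ∷ xs)) (cong (_∷ʳ a) rev) ,
    trans (length-++ ys) (trans (+-comm (length ys) 1) (cong suc len))

  split-walk-at : ∀ {u a xs b} → u ∈ a ∷ xs → Walk a xs b →
    ∃₂ λ ys zs → xs ≡ ys ++ zs × Walk a ys u × Walk u zs b
  split-walk-at (here refl) w = [] , _ , refl , [] , w
  split-walk-at (there u∈) (e ∷ w) with split-walk-at u∈ w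
  ... | ys , zs , refl , w₁ , w₂ = _ ∷ ys , zs , refl , e ∷ w₁ , w₂

  walk-init : ∀ {a xs b} → Walk a xs b → ∃ λ as → a ∷ xs ≡ as ∷ʳ b
  walk-init []      = [] , refl
  walk-init {a} (e ∷ w) = let as , eq = walk-init w in a ∷ as , cong (a ∷_) eq

  record BoundedWalk (a b : V G) (d : ℕ) : Set where
    constructor bounded
    field
      {path}  : List (V G)
      walk    : Walk a path b
      length≤ : length path ≤ d

  DistLe⇒BoundedWalk : ∀ {a b d} → DistLe G a b d → BoundedWalk a b d
  DistLe⇒BoundedWalk (w , is-walk , refl , refl , length≤) = bounded (IsWalk⇒walk w is-walk) length≤

  BoundedWalk-reverse : ∀ {a b d} → BoundedWalk a b d → BoundedWalk b a d
  BoundedWalk-reverse (bounded w length≤) =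
    let _ , w′ , _ , len = reverse-walk w in bounded w′ (subst (_≤ _) (sym len) length≤)

  DistGe : V G → V G → ℕ → Set
  DistGe a b ℓ = ∀ {xs} → Walk a xs b → ℓ ≤ length xs

  DistGe-sym : ∀ {a b ℓ} → DistGe a b ℓ → DistGe b a ℓ
  DistGe-sym d w = let _ , w′ , _ , len = reverse-walk w in subst (_ ≤_) len (d w′)

  geodesic-DistGe : (P : List⁺ (V G)) → IsGeodesic G P → DistGe (Start G P) (End G P) (walkLength G P)
  geodesic-DistGe (p ∷ _) (_ , _ , shortest) w = shortest (p ∷ _) (walk⇒IsWalk w) refl (walk-End w)

  DistGe-infix : ∀ {p ys s qs t ds e} → Walk p ys s → Walk t ds e →
    DistGe p e (length (ys ++ qs ++ ds)) → DistGe s t (length qs)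
  DistGe-infix {ys = ys} {qs = qs} {ds = ds} w₁ w₃ d {zs} w₂ =
    +-cancelʳ-≤ (length ds) (length qs) (length zs)
      (+-cancelˡ-≤ (length ys) _ _
        (subst₂ _≤_ (length-infix qs) (length-infix zs) (d (w₁ ++ʷ w₂ ++ʷ w₃))))
    where
      length-infix : ∀ xs → length (ys ++ xs ++ ds) ≡ length ys + (length xs + length ds)
      length-infix xs = trans (length-++ ys) (cong (length ys +_) (length-++ xs))

  ∈-subpath : ∀ {Q P v} → SubpathOf G Q P → v ∈ toList Q → v ∈ toList P
  ∈-subpath (as , _ , inj₁ eq) v∈ = subst (_ ∈_) (sym eq) (∈-++⁺ʳ as (∈-++⁺ˡ v∈))
  ∈-subpath (as , _ , inj₂ eq) v∈ = reverse⁻ (subst (_ ∈_) (sym eq) (∈-++⁺ʳ as (∈-++⁺ˡ v∈)))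

  subpath-reverse : ∀ {Q Q′ P} → reverse (toList Q) ≡ toList Q′ → SubpathOf G Q P → SubpathOf G Q′ P
  subpath-reverse {Q} {Q′} {P} rev (as , bs , inj₁ eq) =
    reverse bs , reverse as , inj₂ (trans (cong reverse eq) (reverse-infix as (toList Q) bs rev))
  subpath-reverse {Q} {Q′} {P} rev (as , bs , inj₂ eq) =
    reverse bs , reverse as , inj₁ (begin
      toList P                          ≡⟨ sym (reverse-involutive (toList P)) ⟩
      reverse (reverse (toList P))      ≡⟨ cong reverse eq ⟩
      reverse (as ++ toList Q ++ bs)    ≡⟨ reverse-infix as (toList Q) bs rev ⟩
      reverse bs ++ toList Q′ ++ reverse as ∎)
    where open ≡-Reasoning
  
  infix-subpath : ∀ {p ys s} qs ds → Walk p ys s → SubpathOf G (s ∷ qs) (p ∷ ys ++ qs ++ ds)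
  infix-subpath {s = s} qs ds w =
    let as , eq = walk-init w
    in as , ds , inj₁ (trans (cong (_++ qs ++ ds) eq) (++-assoc as [ s ] (qs ++ ds)))

  geodesic-segment : (P : List⁺ (V G)) → IsGeodesic G P → ∀ {u u′} → u ∈ toList P → u′ ∈ toList P →
    ∃ λ qs → SubpathOf G (u ∷ qs) P × Walk u qs u′ × DistGe u u′ (length qs)
  geodesic-segment (p ∷ ps) geo u∈ u′∈ with split-walk-at u∈ (IsWalk⇒walk (p ∷ ps) (proj₁ geo))
  ... | ys , zs , refl , w₁ , w₂ with ∈-++⁻ (p ∷ ys) u′∈
  ...   | inj₂ u′∈zs with split-walk-at (there u′∈zs) w₂
  ...     | qs , ds , refl , w , w₃ =
    qs , infix-subpath qs ds w₁ , w , DistGe-infix w₁ w₃ (geodesic-DistGe (p ∷ ps) geo)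
  geodesic-segment (p ∷ ps) geo u∈ u′∈ | ys , zs , refl , w₁ , w₂ | inj₁ u′∈ys
    with split-walk-at u′∈ys w₁
  ... | ys₁ , qs , refl , w₀ , w with reverse-walk w
  ...   | rs , w′ , rev , len =
    rs , subpath-reverse rev sub , w′ , subst (DistGe _ _) (sym len) (DistGe-sym dist)
    where
      assoc : (ys₁ ++ qs) ++ zs ≡ ys₁ ++ qs ++ zs
      assoc = ++-assoc ys₁ qs zs
      sub : SubpathOf G (_ ∷ qs) (p ∷ (ys₁ ++ qs) ++ zs)
      sub = subst (λ xs → SubpathOf G _ (p ∷ xs)) (sym assoc) (infix-subpath qs zs w₀)
      dist : DistGe _ _ (length qs)
      dist = DistGe-infix w₀ w₂ (subst (DistGe p _) (cong length assoc) (geodesic-DistGe (p ∷ _) geo))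

  split-at-last-or-start : ∀ {P : Pred (V G) 0ℓ} → Decidable P → ∀ {a xs b} → Walk a xs b →
    ∃ λ y → ∃₂ λ ys zs → xs ≡ ys ++ zs × Walk a ys y × Walk y zs b × (ys ≡ [] ⊎ P y) × All (∁ P) zs
  split-at-last-or-start P? [] = _ , [] , [] , refl , [] , [] , inj₁ refl , []
  split-at-last-or-start P? (e ∷ w) with split-at-last-or-start P? w
  ... | y , ys , zs , refl , w₁ , w₂ , inj₂ py , ¬P = y , _ ∷ ys , zs , refl , e ∷ w₁ , w₂ , inj₂ py , ¬P
  ... | y , [] , zs , refl , [] , w₂ , inj₁ refl , ¬P with P? y
  ...   | yes py = y , y ∷ [] , zs , refl , e ∷ [] , w₂ , inj₂ py , ¬P
  ...   | no ¬py = _ , [] , y ∷ zs , refl , [] , e ∷ w₂ , inj₁ refl , ¬py ∷ ¬P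

  split-at-last : ∀ {P : Pred (V G) 0ℓ} → Decidable P → ∀ {a xs b} → P a → Walk a xs b →
    ∃ λ y → ∃₂ λ ys zs → xs ≡ ys ++ zs × Walk a ys y × Walk y zs b × P y × All (∁ P) zs
  split-at-last P? pa w with split-at-last-or-start P? w
  ... | y , ys , zs , eq , w₁ , w₂ , inj₂ py , ¬P = y , ys , zs , eq , w₁ , w₂ , py , ¬P
  ... | y , [] , zs , eq , [] , w₂ , inj₁ refl , ¬P = y , [] , zs , eq , [] , w₂ , pa , ¬P

module _ (G : Graph) where
  open Walks G

  concat-walk : ∀ m (Qs : Fin m → List⁺ (V G)) (Rs : Fin (suc m) → List⁺ (V G)) →
    (∀ i → IsWalk G (Qs i)) → (∀ i → IsWalk G (Rs i)) →
    (∀ i → End G (Rs (inject₁ i)) ≡ Start G (Qs i)) → (∀ i → End G (Qs i) ≡ Start G (Rs (fsuc i))) →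
    ∃ λ ws → Walk (Start G (Rs fzero)) ws (End G (Rs (fromℕ m))) ×
             length ws ≡ sumFin G (walkLength G ∘ Rs) + sumFin G (walkLength G ∘ Qs)
  concat-walk zero Qs Rs Q-walk R-walk _ _ =
    tail (Rs fzero) , IsWalk⇒walk (Rs fzero) (R-walk fzero) ,
    sym (trans (+-identityʳ _) (+-identityʳ _))
  concat-walk (suc m) Qs Rs Q-walk R-walk link₁ link₂ =
    let ws , w , len = concat-walk m (Qs ∘ fsuc) (Rs ∘ fsuc) (Q-walk ∘ fsuc) (R-walk ∘ fsuc)
                                   (link₁ ∘ fsuc) (link₂ ∘ fsuc)
    in tail R₀ ++ tail Q₀ ++ ws ,
       IsWalk⇒walk R₀ (R-walk fzero) ++ʷ⟨ link₁ fzero ⟩ IsWalk⇒walk Q₀ (Q-walk fzero) ++ʷ⟨ link₂ fzero ⟩ w ,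
       (begin
         length (tail R₀ ++ tail Q₀ ++ ws)            ≡⟨ length-++ (tail R₀) ⟩
         length (tail R₀) + length (tail Q₀ ++ ws)    ≡⟨ cong (length (tail R₀) +_) (length-++ (tail Q₀)) ⟩
         length (tail R₀) + (length (tail Q₀) + length ws)
           ≡⟨ cong (λ l → length (tail R₀) + (length (tail Q₀) + l)) len ⟩
         length (tail R₀) + (length (tail Q₀) + (ΣR + ΣQ)) ≡⟨ interchange (length (tail R₀)) (length (tail Q₀)) ΣR ΣQ ⟩
         (length (tail R₀) + ΣR) + (length (tail Q₀) + ΣQ) ∎)
    where
      open ≡-Reasoning
      R₀ Q₀ : List⁺ (V G)
      R₀ = Rs fzero
      Q₀ = Qs fzero
      ΣR ΣQ : ℕ
      ΣR = sumFin G (walkLength G ∘ Rs ∘ fsuc)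
      ΣQ = sumFin G (walkLength G ∘ Qs ∘ fsuc)
      interchange : ∀ r q R Q → r + (q + (R + Q)) ≡ (r + R) + (q + Q)
      interchange = solve-∀

  snappath-walk : ∀ {k ρ 𝒫} (S : Snappath G k ρ 𝒫) → Σ (List⁺ (V G)) λ w →
    IsWalk G w × Start G w ≡ Snappath.sStart S × End G w ≡ Snappath.sEnd S × walkLength G w ≡ Snappath.sLength S
  snappath-walk S =
    let ws , w , len = concat-walk k' Qs Rs Q-walk R-walk link₁ link₂
    in sStart ∷ ws , walk⇒IsWalk w , refl , walk-End w , len
    where open Snappath S

module Construction (G : Graph) (k ρ : ℕ) (𝒫 : Fin k → List⁺ (V G)) (cover : IsGeodesicCover G k ρ 𝒫) where
  open Graph G using (Adj)
  open Walks G
  open BoundedWalk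
  open DecMembership (_≟ᶠ_ {Graph.n G}) using (_∈?_)

  anchor : V G → V G
  anchor v = proj₁ (proj₂ (proj₂ cover v))

  anchor-on-cover : ∀ v → anchor v ∈ toList (𝒫 (proj₁ (proj₂ cover v)))
  anchor-on-cover v = proj₁ (proj₂ (proj₂ (proj₂ cover v)))

  to-anchor : ∀ v → BoundedWalk v (anchor v) ρ
  to-anchor v = DistLe⇒BoundedWalk (proj₂ (proj₂ (proj₂ (proj₂ cover v))))

  from-anchor : ∀ v → BoundedWalk (anchor v) v ρ
  from-anchor v = BoundedWalk-reverse (to-anchor v)

  Cogeodesic : V G → V G → Set
  Cogeodesic x y = ∃[ j ] (anchor x ∈ toList (𝒫 j) × anchor y ∈ toList (𝒫 j))

  cogeodesic? : ∀ x → Decidable (Cogeodesic x)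
  cogeodesic? x y = any? λ j → (anchor x ∈? toList (𝒫 j)) ×-dec (anchor y ∈? toList (𝒫 j))

  cogeodesic-refl : ∀ x → Cogeodesic x x
  cogeodesic-refl x = _ , anchor-on-cover x , anchor-on-cover x

  -- The detour x → anchor x → anchor y → y along a cover geodesic, replacing the stretch x ∷ xs of P.
  -- Its middle part is a segment of a geodesic, hence no longer than anchor x → x → y → anchor y.
  record Hop (x y : V G) (xs : List (V G)) : Set where
    field
      geodesic : Fin k
      qs       : List (V G)
      subpath  : SubpathOf G (anchor x ∷ qs) (𝒫 geodesic)
      q-walk   : Walk (anchor x) qs (anchor y)
      cost     : length (path (to-anchor x)) + (length qs + length (path (from-anchor y))) ≤ length xs + 4 * ρ

  hop : ∀ {x y xs} → Walk x xs y → Cogeodesic x y → Hop x y xs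
  hop {x} {y} {xs} w (j , x∈ , y∈) =
    let qs , sub , q-walk , dist = geodesic-segment (𝒫 j) (proj₁ cover j) x∈ y∈
        qs≤ : length qs ≤ ρ + (length xs + ρ)
        qs≤ = begin
          length qs                                                           ≤⟨ dist (walk (from-anchor x) ++ʷ w ++ʷ walk (to-anchor y)) ⟩
          length (path (from-anchor x) ++ xs ++ path (to-anchor y))
            ≡⟨ trans (length-++ (path (from-anchor x))) (cong (length (path (from-anchor x)) +_) (length-++ xs)) ⟩
          length (path (from-anchor x)) + (length xs + length (path (to-anchor y)))
            ≤⟨ +-mono-≤ (length≤ (from-anchor x)) (+-monoʳ-≤ (length xs) (length≤ (to-anchor y))) ⟩
          ρ + (length xs + ρ) ∎
        cost : length (path (to-anchor x)) + (length qs + length (path (from-anchor y))) ≤ length xs + 4 * ρ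
        cost = begin
          length (path (to-anchor x)) + (length qs + length (path (from-anchor y)))
            ≤⟨ +-mono-≤ (length≤ (to-anchor x)) (+-mono-≤ qs≤ (length≤ (from-anchor y))) ⟩
          ρ + ((ρ + (length xs + ρ)) + ρ) ≡⟨ four-ρ (length xs) ρ ⟩
          length xs + 4 * ρ ∎
    in record { geodesic = j ; qs = qs ; subpath = sub ; q-walk = q-walk ; cost = cost }
    where
      open ≤-Reasoning
      four-ρ : ∀ l ρ → ρ + ((ρ + (l + ρ)) + ρ) ≡ l + 4 * ρ
      four-ρ = solve-∀

  -- Q₁ R₁ … Q_{m+1} R_{m+1} of a snappath following the stretch x ∷ xs of P, which ends at e.
  -- R₀, the walk from x to its anchor, is prepended only at the very end, but cost already counts it.
  record SnapTail (e x : V G) (xs : List (V G)) : Set where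
    field
      m          : ℕ
      Qs Rs      : Fin (suc m) → List⁺ (V G)
      Q-walk     : ∀ i → IsWalk G (Qs i)
      R-walk     : ∀ i → IsWalk G (Rs i)
      Q-sub      : ∀ i → ∃[ j ] SubpathOf G (Qs i) (𝒫 j)
      Q-once     : ∀ j i i′ → SubpathOf G (Qs i) (𝒫 j) → SubpathOf G (Qs i′) (𝒫 j) → i ≡ i′
      R-len      : ∀ i → walkLength G (Rs i) ≤ 2 * ρ + 1
      Rlast-len  : walkLength G (Rs (fromℕ m)) ≤ ρ
      Q-anchored : ∀ i → ∃[ w ] (w ∈ x ∷ xs × Start G (Qs i) ≡ anchor w)
      Q₀-start   : Start G (Qs fzero) ≡ anchor x
      link       : ∀ i → End G (Qs i) ≡ Start G (Rs i)
      link′      : ∀ i → End G (Rs (inject₁ i)) ≡ Start G (Qs (fsuc i))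
      Rlast-end  : End G (Rs (fromℕ m)) ≡ e
      cost       : (length (path (to-anchor x)) + sumFin G (walkLength G ∘ Rs)) + sumFin G (walkLength G ∘ Qs)
                     ≤ length xs + 4 * ρ * suc m

  last-hop : ∀ {x e xs} → Walk x xs e → Cogeodesic x e → SnapTail e x xs
  last-hop {x} {e} {xs} w xe = record
    { m = 0 ; Qs = λ _ → anchor x ∷ qs ; Rs = λ _ → anchor e ∷ path (from-anchor e)
    ; Q-walk = λ _ → walk⇒IsWalk q-walk ; R-walk = λ _ → walk⇒IsWalk (walk (from-anchor e))
    ; Q-sub = λ _ → geodesic , subpath
    ; Q-once = λ { _ fzero fzero _ _ → refl }
    ; R-len = λ _ → ≤-trans (length≤ (from-anchor e)) (n≤2n+1 ρ)
    ; Rlast-len = length≤ (from-anchor e)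
    ; Q-anchored = λ _ → x , here refl , refl
    ; Q₀-start = refl
    ; link = λ _ → walk-End q-walk
    ; link′ = λ ()
    ; Rlast-end = walk-End (walk (from-anchor e))
    ; cost = subst₂ _≤_ (regroup (length (path (to-anchor x))) (length qs) (length (path (from-anchor e))))
                       (sym (times-one (length xs) ρ)) hop-cost }
    where
      open Hop (hop w xe) renaming (cost to hop-cost)
      regroup : ∀ a q r → a + (q + r) ≡ (a + (r + 0)) + (q + 0)
      regroup = solve-∀
      times-one : ∀ l ρ → l + 4 * ρ * 1 ≡ l + 4 * ρ
      times-one = solve-∀

  hop-then : ∀ {e x y z ys zs} → Walk x ys y → Cogeodesic x y → Adj y z →
             All (∁ (Cogeodesic x)) (z ∷ zs) → SnapTail e z zs → SnapTail e x (ys ++ z ∷ zs)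
  hop-then {e} {x} {y} {z} {ys} {zs} w xy y~z ¬xzs T = record
    { m = suc T.m ; Qs = Qs ; Rs = Rs
    ; Q-walk = λ { fzero → walk⇒IsWalk q-walk ; (fsuc i) → T.Q-walk i }
    ; R-walk = λ { fzero → walk⇒IsWalk bridge ; (fsuc i) → T.R-walk i }
    ; Q-sub = λ { fzero → geodesic , subpath ; (fsuc i) → T.Q-sub i }
    ; Q-once = Q-once
    ; R-len = λ { fzero → bridge-len ; (fsuc i) → T.R-len i }
    ; Rlast-len = T.Rlast-len
    ; Q-anchored = λ { fzero → x , here refl , refl
                     ; (fsuc i) → let v , v∈ , eq = T.Q-anchored i in v , there (∈-++⁺ʳ ys v∈) , eq }
    ; Q₀-start = refl
    ; link = λ { fzero → walk-End q-walk ; (fsuc i) → T.link i }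
    ; link′ = λ { fzero → trans (walk-End bridge) (sym T.Q₀-start) ; (fsuc i) → T.link′ i }
    ; Rlast-end = T.Rlast-end
    ; cost = cost }
    where
      module T = SnapTail T
      open Hop (hop w xy) renaming (cost to hop-cost)
      open ≤-Reasoning

      Qs : Fin (suc (suc T.m)) → List⁺ (V G)
      Qs fzero    = anchor x ∷ qs
      Qs (fsuc i) = T.Qs i

      bridge : Walk (anchor y) (path (from-anchor y) ++ z ∷ path (to-anchor z)) (anchor z)
      bridge = walk (from-anchor y) ++ʷ y~z ∷ walk (to-anchor z)

      Rs : Fin (suc (suc T.m)) → List⁺ (V G)
      Rs fzero    = anchor y ∷ path (from-anchor y) ++ z ∷ path (to-anchor z)
      Rs (fsuc i) = T.Rs i

      bridge-len : walkLength G (Rs fzero) ≤ 2 * ρ + 1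
      bridge-len = begin
        length (path (from-anchor y) ++ z ∷ path (to-anchor z))    ≡⟨ length-++ (path (from-anchor y)) ⟩
        length (path (from-anchor y)) + suc (length (path (to-anchor z)))
          ≤⟨ +-mono-≤ (length≤ (from-anchor y)) (s≤s (length≤ (to-anchor z))) ⟩
        ρ + suc ρ                                                  ≡⟨ two-ρ+1 ρ ⟩
        2 * ρ + 1 ∎
        where
          two-ρ+1 : ∀ ρ → ρ + suc ρ ≡ 2 * ρ + 1
          two-ρ+1 = solve-∀

      clash : ∀ j i → SubpathOf G (Qs fzero) (𝒫 j) → SubpathOf G (T.Qs i) (𝒫 j) → ⊥
      clash j i sub₀ subᵢ =
        let v , v∈ , eq = T.Q-anchored i
        in All.lookup ¬xzs v∈ (j , ∈-subpath sub₀ (here refl) , subst (_∈ _) eq (∈-subpath subᵢ (here refl)))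

      Q-once : ∀ j i i′ → SubpathOf G (Qs i) (𝒫 j) → SubpathOf G (Qs i′) (𝒫 j) → i ≡ i′
      Q-once j fzero    fzero     _ _ = refl
      Q-once j fzero    (fsuc i′) s s′ = ⊥-elim (clash j i′ s s′)
      Q-once j (fsuc i) fzero     s s′ = ⊥-elim (clash j i s′ s)
      Q-once j (fsuc i) (fsuc i′) s s′ = cong fsuc (T.Q-once j i i′ s s′)

      a r a′ : ℕ
      a  = length (path (to-anchor x))
      r  = length (path (from-anchor y))
      a′ = length (path (to-anchor z))
      ΣR ΣQ : ℕ
      ΣR = sumFin G (walkLength G ∘ T.Rs)
      ΣQ = sumFin G (walkLength G ∘ T.Qs)

      cost : (a + sumFin G (walkLength G ∘ Rs)) + sumFin G (walkLength G ∘ Qs)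
               ≤ length (ys ++ z ∷ zs) + 4 * ρ * suc (suc T.m)
      cost = begin
        (a + (length (path (from-anchor y) ++ z ∷ path (to-anchor z)) + ΣR)) + (length qs + ΣQ)
          ≡⟨ cong (λ l → (a + (l + ΣR)) + (length qs + ΣQ)) (length-++ (path (from-anchor y))) ⟩
        (a + ((r + suc a′) + ΣR)) + (length qs + ΣQ)   ≡⟨ regroup a (length qs) r a′ ΣR ΣQ ⟩
        (a + (length qs + r)) + suc ((a′ + ΣR) + ΣQ)   ≤⟨ +-mono-≤ hop-cost (s≤s T.cost) ⟩
        (length ys + 4 * ρ) + suc (length zs + 4 * ρ * suc T.m)  ≡⟨ merge (length ys) (length zs) ρ T.m ⟩
        (length ys + suc (length zs)) + 4 * ρ * suc (suc T.m)    ≡⟨ cong (_+ 4 * ρ * suc (suc T.m)) (sym (length-++ ys)) ⟩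
        length (ys ++ z ∷ zs) + 4 * ρ * suc (suc T.m) ∎
        where
          regroup : ∀ a q r a′ R Q → (a + ((r + suc a′) + R)) + (q + Q) ≡ (a + (q + r)) + suc ((a′ + R) + Q)
          regroup = solve-∀
          merge : ∀ l l′ ρ m → (l + 4 * ρ) + suc (l′ + 4 * ρ * suc m) ≡ (l + suc l′) + 4 * ρ * suc (suc m)
          merge = solve-∀

  snaptail-along : ∀ {e x xs} → Acc _<_ (length xs) → Walk x xs e → SnapTail e x xs
  snaptail-along {x = x} (acc rec) w with split-at-last (cogeodesic? x) (cogeodesic-refl x) w
  ... | _ , ys , []     , refl , w₁ , []        , xy , _    =
    subst (SnapTail _ x) (sym (++-identityʳ ys)) (last-hop w₁ xy)
  ... | _ , ys , z ∷ zs , refl , w₁ , y~z ∷ w₂ , xy , ¬xzs =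
    hop-then w₁ xy y~z ¬xzs (snaptail-along (rec shorter) w₂)
    where
      shorter : length zs < length (ys ++ z ∷ zs)
      shorter = subst (length zs <_) (sym (length-++ ys)) (m≤n+m (suc (length zs)) (length ys))

  snappath-along : (P : List⁺ (V G)) → IsGeodesic G P → Σ (Snappath G k ρ 𝒫) λ S →
    Snappath.sStart S ≡ Start G P × Snappath.sEnd S ≡ End G P × Snappath.sLength S ≤ walkLength G P + 4 * ρ * k
  snappath-along (p ∷ ps) geo =
    S , refl , T.Rlast-end , ≤-trans T.cost (+-monoʳ-≤ (length ps) (*-monoʳ-≤ (4 * ρ) k′≤k))
    where
      module T = SnapTail (snaptail-along (<-wellFounded (length ps)) (IsWalk⇒walk (p ∷ ps) (proj₁ geo)))

      k′≤k : suc T.m ≤ k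
      k′≤k = injective⇒≤ {f = proj₁ ∘ T.Q-sub} λ {i} {i′} eq →
        T.Q-once _ i i′ (proj₂ (T.Q-sub i)) (subst (λ j → SubpathOf G (T.Qs i′) (𝒫 j)) (sym eq) (proj₂ (T.Q-sub i′)))

      Rs : Fin (suc (suc T.m)) → List⁺ (V G)
      Rs fzero    = p ∷ path (to-anchor p)
      Rs (fsuc i) = T.Rs i

      S : Snappath G k ρ 𝒫
      S = record
        { k' = suc T.m ; k'≤k = k′≤k ; Qs = T.Qs ; Rs = Rs
        ; Q-walk = T.Q-walk
        ; R-walk = λ { fzero → walk⇒IsWalk (walk (to-anchor p)) ; (fsuc i) → T.R-walk i }
        ; Q-sub = T.Q-sub ; Q-once = T.Q-once
        ; R-len = λ { fzero → ≤-trans (length≤ (to-anchor p)) (n≤2n+1 ρ) ; (fsuc i) → T.R-len i }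
        ; R₀-len = length≤ (to-anchor p)
        ; Rlast-len = T.Rlast-len
        ; link₁ = λ { fzero → trans (walk-End (walk (to-anchor p))) (sym T.Q₀-start) ; (fsuc i) → T.link′ i }
        ; link₂ = T.link }

lemma3p1 : (G : Graph) (k ρ : ℕ) → GeodesicCoverable G k ρ →
    (𝒫 : Fin k → List⁺ (V G)) → IsGeodesicCover G k ρ 𝒫 →
    (P : List⁺ (V G)) → IsGeodesic G P →
    Σ (Snappath G k ρ 𝒫) λ Q →
      Snappath.sStart Q ≡ Start G P × Snappath.sEnd Q ≡ End G P ×
      ∣ walkLength G P - Snappath.sLength Q ∣ ≤ 4 * ρ * k
lemma3p1 G k ρ _ 𝒫 cover P geo =
  let S , start , end , upper = snappath-along P geo
      w , is-walk , w-start , w-end , w-length = snappath-walk G S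
      lower : walkLength G P ≤ Snappath.sLength S
      lower = subst (walkLength G P ≤_) w-length
                (proj₂ (proj₂ geo) w is-walk (trans w-start start) (trans w-end end))
  in S , start , end , ∣m-n∣≤o lower upper
  where open Construction G k ρ 𝒫 cover
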